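{- Let $A=(\Sigma,G,\mathcal{I})$ and $A'=(\Sigma',G',\mathcal{I}')$ be non-interactive proto-algorithms with $\mathcal{I}=(D,D_{\mathrm{in}},D_{\mathrm{out}},I)$ and $\mathcal{I}'=(D',D'_{\mathrm{in}},D'_{\mathrm{out}},I')$. Let $R\subseteq \mathcal{S}_A\times\mathcal{S}_{A'}$ and let $f_I\colon D_{\mathrm{in}}\to D'_{\mathrm{in}}$ be a function such that for all $d_{\mathrm{in}}\in D_{\mathrm{in}}$, $((d_{\mathrm{in}},(\bot,\bot),\bot),(f_I(d_{\mathrm{in}}),(\bot,\bot),\bot))\in R$. If $R$ is an algorithmic simulation of $A$ by $A'$, then for all $d_{\mathrm{in}}\in D_{\mathrm{in}}$ and all $\sigma\in\mathrm{arun}_A(d_{\mathrm{in}})$ there exists $\sigma'\in\mathrm{arun}_{A'}(f_I(d_{\mathrm{in}}))$ such that $(\sigma[n],\sigma'[n])\in R$ for all positive natural numbers $n$.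
   Context: A rooted labeled directed graph is a sextuple $(V,E,L_v,L_e,l,r)$ with $V$ a non-empty finite set, $E\subseteq V\times V$, $L_v,L_e$ countable sets, $l$ a partial function on $V\cup E$ sending vertices into $L_v$ and edges into $L_e$, and $r\in V$ the root. A cycle is a sequence $v_1\ldots v_{n+1}$ with $(v_i,v_{i+1})\in E$ for $i\le n$, $v_1,\dots,v_n$ pairwise distinct and $v_1=v_{n+1}$. $\mathrm{indeg}(v)$ and $\mathrm{outdeg}(v)$ are the numbers of in- and out-neighbours of $v$. A non-interactive alphabet is $\Sigma=(F,P)$ with $F,P$ disjoint countable sets (function and predicate symbols) and distinguished symbols $\mathsf{ini},\mathsf{fin}\in F$; write $\widetilde F=F\setminus\{\mathsf{ini},\mathsf{fin}\}$. A non-interactive $\Sigma$-algorithm graph is a rooted labeled directed graph $(V,E,L_v,L_e,l,r)$ with $L_v=F\cup P$, $L_e=\{0,1\}$, such that for all $v\in V$: $\mathrm{indeg}(v)=0$ iff $v=r$; $l(v)=\mathsf{ini}$ iff $\mathrm{indeg}(v)=0$; $l(v)=\mathsf{fin}$ iff $\mathrm{outdeg}(v)=0$; if $l(v)\in F$ then $l((v,v'))$ is undefined for every edge $(v,v')$; if $l(v)\in P$ then $\mathrm{outdeg}(v)=2$ and the two outgoing edges carry defined, distinct labels; and every cycle contains a vertex labeled by an element of $F$. A set $\mathcal A$ is finitely generated if there are a finite $\mathcal A'\subseteq\mathcal A$ and a finite set $\mathcal F$ of functions on $\mathcal A$ such that every $\mathcal A''$ with $\mathcal A'\subseteq\mathcal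 A''\subseteq\mathcal A$ has closure under $\mathcal F$ equal to $\mathcal A$. A non-interactive $\Sigma$-interpretation is $(D,D_{\mathrm{in}},D_{\mathrm{out}},I)$ with $D$ a set, $D_{\mathrm{in}},D_{\mathrm{out}}$ finitely generated sets, and $I$ assigning to each symbol a total computable function: $I(\mathsf{ini})\colon D_{\mathrm{in}}\to D$, $I(\mathsf{fin})\colon D\to D_{\mathrm{out}}$, $I(f)\colon D\to D$ for $f\in\widetilde F$, $I(p)\colon D\to\{0,1\}$ for $p\in P$; moreover there is no proper subset $D'\subset D$ containing all $I(\mathsf{ini})(d_{\mathrm{in}})$ and closed under all $I(f)$, $f\in\widetilde F$. A non-interactive proto-algorithm is a triple $A=(\Sigma,G,\mathcal I)$ of a non-interactive alphabet, a non-interactive $\Sigma$-algorithm graph $G=(V,E,L_v,L_e,l,r)$ and a non-interactive $\Sigma$-interpretation $\mathcal I=(D,D_{\mathrm{in}},D_{\mathrm{out}},I)$. A dummy value $\bot$ lies outside $V,D,D_{\mathrm{in}},D_{\mathrm{out}}$; $X_\bot=X\cup\{\bot\}$. A state of $A$ is a triple $(d_{\mathrm{in}},(v,d),d_{\mathrm{out}})\in (D_{\mathrm{in}})_\bot\times(V_\bot\times D_\bot)\times(D_{\mathrm{out}})_\bot$ with: $v=\bot$ iff $d=\bot$; if $(v,d)=(\bot,\bot)$ then $d_{\mathrm{in}}=\bot$ iff $d_{\mathrm{out}}\ne\bot$; if $(v,d)\neq(\bot,\bot)$ then $d_{\mathrm{in}}=d_{\mathrm{out}}=\bot$. $\mathcal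 S_A$ is the set of states; initial states are those in $D_{\mathrm{in}}\times\{(\bot,\bot)\}\times\{\bot\}$, final states those in $\{\bot\}\times\{(\bot,\bot)\}\times D_{\mathrm{out}}$, internal states those in $\{\bot\}\times(V\times D)\times\{\bot\}$ (sets $\mathcal S^{\mathrm{ini}}_A,\mathcal S^{\mathrm{fin}}_A,\mathcal S^{\mathrm{int}}_A$). The algorithmic step function $\mathrm{astep}_A$ is the smallest (pointwise under inclusion) total function from $\mathcal S_A$ to non-empty subsets of $\mathcal S_A$ such that, for all $d,d'\in D$, $d_{\mathrm{in}}\in D_{\mathrm{in}}$, $d_{\mathrm{out}}\in D_{\mathrm{out}}$, $v,v'\in V$: $(\bot,(v',d'),\bot)\in\mathrm{astep}_A((d_{\mathrm{in}},(\bot,\bot),\bot))$ if $l(r)=\mathsf{ini}$, $(r,v')\in E$, $I(\mathsf{ini})(d_{\mathrm{in}})=d'$; $(\bot,(v',d'),\bot)\in\mathrm{astep}_A((\bot,(v,d),\bot))$ if $l(v)\in\widetilde F$, $(v,v')\in E$, $I(l(v))(d)=d'$; $(\bot,(v',d),\bot)\in\mathrm{astep}_A((\bot,(v,d),\bot))$ if $l(v)\in P$, $(v,v')\in E$, $I(l(v))(d)=l((v,v'))$; $(\bot,(\bot,\bot),d_{\mathrm{out}})\in\mathrm{astep}_A((\bot,(v,d),\bot))$ if $l(v)=\mathsf{fin}$ and $I(\mathsf{fin})(d)=d_{\mathrm{out}}$; $(\bot,(\bot,\bot),d_{\mathrm{out}})\in\mathrm{astep}_A((\bot,(\bot,\bot),d_{\mathrm{out}}))$.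 Sequences are non-empty, finite or countably infinite. For a state $s$, $\mathrm{asruns}_A(s)$ is given by $\mathrm{asruns}_A(s)=\{\langle s\rangle\frown\tau : \exists s'\in\mathrm{astep}_A(s),\ \tau\in\mathrm{asruns}_A(s')\}$ if $s$ is not final and $\{\langle s\rangle\}$ if $s$ is final (including infinite sequences), i.e. the sequences starting in $s$, each next element being in $\mathrm{astep}_A$ of the previous, stopping exactly when a final state is reached. $\mathrm{arun}_A(d_{\mathrm{in}})=\mathrm{asruns}_A((d_{\mathrm{in}},(\bot,\bot),\bot))$. For a sequence $\sigma$, $\sigma[n]$ is its $n$th element if $\sigma$ has length at least $n$ and its last element otherwise. An algorithmic simulation of $A$ by $A'$ is $R\subseteq\mathcal S_A\times\mathcal S_{A'}$ such that: every initial state of $A$ is related by $R$ to some initial state of $A'$; every final state of $A'$ is related (as second component) to some final state of $A$; if $(s,s')\in R$ and $t\in\mathrm{astep}_A(s)$ then there is $t'\in\mathrm{astep}_{A'}(s')$ with $(t,t')\in R$; and for all $(s,s')\in R$, $s$ is initial iff $s'$ is initial, and $s$ is final iff $s'$ is final. -}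

module Defs where

open import Data.Nat using (ℕ; zero; suc; _+_; _∸_)
open import Data.Bool using (Bool; true; false; if_then_else_)
open import Data.Fin using (Fin; zero; suc; inject₁; fromℕ)
open import Data.Maybe using (Maybe; just; nothing)
open import Data.Sum using (_⊎_; inj₁; inj₂)
open import Data.Product using (Σ; Σ-syntax; ∃; _×_; _,_)
open import Data.List using (List)
open import Data.List.Membership.Propositional using (_∈_)
open import Data.Vec using (Vec; lookup)
open import Data.Empty using (⊥)
open import Function using (_∘_; _⇔_)
open import Function.Definitions using (Injective)
open import Relation.Nullary using (¬_)
open import Relation.Binary.PropositionalEquality using (_≡_; _≢_; refl)

Countable : Set → Set
Countable X = Σ (X → ℕ) (λ c → Injective _≡_ _≡_ c)

FinOps : Set → Set
FinOps A = List (Σ ℕ λ k → Vec A k → A)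

data Closure {A : Set} (B : A → Set) (fs : FinOps A) : A → Set where
  base : ∀ {a} → B a → Closure B fs a
  app  : ∀ {k g} → (k , g) ∈ fs → (as : Vec A k) →
         (∀ i → Closure B fs (lookup as i)) → Closure B fs (g as)

FinitelyGenerated : Set → Set₁
FinitelyGenerated A =
  Σ (List A) λ A' → Σ (FinOps A) λ fs →
    (A'' : A → Set) → (∀ a → a ∈ A' → A'' a) → ∀ a → Closure A'' fs a

count : ∀ {n} → (Fin n → Bool) → ℕ
count {zero}  p = 0
count {suc n} p = (if p zero then 1 else 0) + count (p ∘ suc)

record Alphabet : Set₁ where
  field
    F P     : Set
    F-count : Countable F
    P-count : Countable P
    ini fin : F
    ini≢fin : ini ≢ fin

InFtilde : (Σ' : Alphabet) → Alphabet.F Σ' → Set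
InFtilde Σ' f = f ≢ Alphabet.ini Σ' × f ≢ Alphabet.fin Σ'

-- V = Fin n, E given by a Boolean adjacency (edge (u,v) ∈ E iff E u v ≡ true),
-- vertex labels lv (partial, into F ⊎ P), edge labels le (partial, into {0,1} = Bool),
-- root r.

module _ (Σ' : Alphabet) where
  open Alphabet Σ'

  indegE outdegE : ∀ {n} → (Fin n → Fin n → Bool) → Fin n → ℕ
  indegE  E v = count (λ u → E u v)
  outdegE E v = count (λ u → E v u)

  -- cycle v₁ … v_{m+2} (m+1 ≥ 1 edges), v₁ … v_{m+1} pairwise distinct, v₁ = v_{m+2}
  IsCycleE : ∀ {n} → (Fin n → Fin n → Bool) → (m : ℕ) → (Fin (suc (suc m)) → Fin n) → Set
  IsCycleE E m c =
    (∀ (i : Fin (suc m)) → E (c (inject₁ i)) (c (suc i)) ≡ true) ×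
    (∀ (i j : Fin (suc m)) → c (inject₁ i) ≡ c (inject₁ j) → i ≡ j) ×
    c zero ≡ c (fromℕ (suc m))

  record AlgGraph : Set where
    field
      n  : ℕ
      E  : Fin n → Fin n → Bool
      lv : Fin n → Maybe (F ⊎ P)
      le : Fin n → Fin n → Maybe Bool
      r  : Fin n
      root-indeg   : ∀ v → (indegE E v ≡ 0) ⇔ (v ≡ r)
      ini-indeg    : ∀ v → (lv v ≡ just (inj₁ ini)) ⇔ (indegE E v ≡ 0)
      fin-outdeg   : ∀ v → (lv v ≡ just (inj₁ fin)) ⇔ (outdegE E v ≡ 0)
      F-no-edgelab : ∀ v f → lv v ≡ just (inj₁ f) →
                     ∀ v' → E v v' ≡ true → le v v' ≡ nothing
      P-outdeg     : ∀ v p → lv v ≡ just (inj₂ p) → outdegE E v ≡ 2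
      P-edgelab    : ∀ v p → lv v ≡ just (inj₂ p) →
                     ∀ u u' → E v u ≡ true → E v u' ≡ true → u ≢ u' →
                     Σ[ b ∈ Bool ] Σ[ b' ∈ Bool ]
                       (le v u ≡ just b × le v u' ≡ just b' × b ≢ b')
      cycle-F      : ∀ m c → IsCycleE E m c →
                     Σ[ i ∈ Fin (suc (suc m)) ] Σ[ f ∈ F ] lv (c i) ≡ just (inj₁ f)

    V : Set
    V = Fin n

  record Interp : Set₁ where
    field
      D Din Dout : Set
      Din-fg  : FinitelyGenerated Din
      Dout-fg : FinitelyGenerated Dout
      Iini : Din → D
      Ifin : D → Dout
      IF   : (f : F) → InFtilde Σ' f → D → D
      IP   : P → D → Bool
      minimal : (D' : D → Set) → (∀ din → D' (Iini din)) →
                (∀ f (h : InFtilde Σ' f) d → D' d → D' (IF f h d)) →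
                ∀ d → D' d

record ProtoAlg : Set₁ where
  field
    Sig : Alphabet
    G   : AlgGraph Sig
    I   : Interp Sig
  open Alphabet Sig public
  open AlgGraph G public
  open Interp I public

-- States (⊥ = nothing)

module _ (A : ProtoAlg) where
  open ProtoAlg A

  Raw : Set
  Raw = Maybe Din × (Maybe V × Maybe D) × Maybe Dout

  IsNothing : ∀ {X : Set} → Maybe X → Set
  IsNothing m = m ≡ nothing

  WF : Raw → Set
  WF (di , (v , d) , dout) =
    ((IsNothing v) ⇔ (IsNothing d)) ×
    (IsNothing v → IsNothing d → (IsNothing di ⇔ (¬ IsNothing dout))) ×
    (¬ (IsNothing v × IsNothing d) → IsNothing di × IsNothing dout)

  record State : Set where
    constructor state
    field
      raw : Raw
      .wf : WF raw

  IsInitial IsFinal IsInternal : State → Set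
  IsInitial  s = Σ[ x ∈ Din ] State.raw s ≡ (just x , (nothing , nothing) , nothing)
  IsFinal    s = Σ[ x ∈ Dout ] State.raw s ≡ (nothing , (nothing , nothing) , just x)
  IsInternal s = Σ[ v ∈ V ] Σ[ d ∈ D ] State.raw s ≡ (nothing , (just v , just d) , nothing)

  initState : Din → State
  initState x = state (just x , (nothing , nothing) , nothing)
    (record { to = λ _ → refl ; from = λ _ → refl ; to-cong = λ _ → refl ; from-cong = λ _ → refl }
    , (λ _ _ → record { to = λ () ; from = λ h → ⊥-e (h refl) ; to-cong = λ _ → refl ; from-cong = λ _ → refl })
    , λ h → ⊥-e (h (refl , refl)))
    where
    ⊥-e : ∀ {X : Set} → ⊥ → X
    ⊥-e ()

  data AStepRaw : Raw → Raw → Set where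
    step-ini : ∀ {x v'} → lv r ≡ just (inj₁ ini) → E r v' ≡ true →
      AStepRaw (just x , (nothing , nothing) , nothing)
               (nothing , (just v' , just (Iini x)) , nothing)
    step-F : ∀ {v v' d f} → lv v ≡ just (inj₁ f) → (h : InFtilde Sig f) →
      E v v' ≡ true →
      AStepRaw (nothing , (just v , just d) , nothing)
               (nothing , (just v' , just (IF f h d)) , nothing)
    step-P : ∀ {v v' d p} → lv v ≡ just (inj₂ p) → E v v' ≡ true →
      le v v' ≡ just (IP p d) →
      AStepRaw (nothing , (just v , just d) , nothing)
               (nothing , (just v' , just d) , nothing)
    step-fin : ∀ {v d} → lv v ≡ just (inj₁ fin) →
      AStepRaw (nothing , (just v , just d) , nothing)
               (nothing , (nothing , nothing) , just (Ifin d))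
    step-final : ∀ {y} →
      AStepRaw (nothing , (nothing , nothing) , just y)
               (nothing , (nothing , nothing) , just y)

  AStep : State → State → Set
  AStep s t = AStepRaw (State.raw s) (State.raw t)

data Seq (X : Set) : Set where
  finite   : (k : ℕ) → (Fin (suc k) → X) → Seq X
  infinite : (ℕ → X) → Seq X

clamp : ℕ → (k : ℕ) → Fin (suc k)
clamp zero    k       = zero
clamp (suc i) zero    = zero
clamp (suc i) (suc k) = suc (clamp i k)

-- σ[n] (1-based): n-th element, or the last element if σ is shorter
_[_] : ∀ {X : Set} → Seq X → ℕ → X
finite k f [ n ] = f (clamp (n ∸ 1) k)
infinite g [ n ] = g (n ∸ 1)

module _ (A : ProtoAlg) where
  open ProtoAlg A

  IsRunFrom : State A → Seq (State A) → Set
  IsRunFrom s (finite k f) =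
    f zero ≡ s ×
    (∀ (i : Fin k) → ¬ IsFinal A (f (inject₁ i)) × AStep A (f (inject₁ i)) (f (suc i))) ×
    IsFinal A (f (fromℕ k))
  IsRunFrom s (infinite g) =
    g 0 ≡ s ×
    (∀ i → ¬ IsFinal A (g i) × AStep A (g i) (g (suc i)))

  IsRun : Din → Seq (State A) → Set
  IsRun x σ = IsRunFrom (initState A x) σ

IsSimulation : (A A' : ProtoAlg) → (State A → State A' → Set) → Set
IsSimulation A A' R =
  (∀ s → IsInitial A s → Σ[ s' ∈ State A' ] IsInitial A' s' × R s s') ×
  (∀ s' → IsFinal A' s' → Σ[ s ∈ State A ] IsFinal A s × R s s') ×
  (∀ s s' → R s s' → ∀ t → AStep A s t → Σ[ t' ∈ State A' ] AStep A' s' t' × R t t') ×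
  (∀ s s' → R s s' → (IsInitial A s ⇔ IsInitial A' s') × (IsFinal A s ⇔ IsFinal A' s'))

-- A simulation lets every step of A be matched by a step of A' between related
-- states, so a run of A is lifted one step at a time, by induction along a finite
-- run and by recursion along an infinite one. Because R relates final states only
-- to final states, the lifted sequence stops exactly when the original one does,
-- hence it is again a run.
module Submission where

open import Defs
open import Data.Nat using (ℕ; _≤_; _∸_; zero; suc)
open import Data.Fin using (Fin; zero; suc; inject₁)
open import Data.Vec.Functional using (_∷_)
open import Data.Product using (Σ-syntax; _×_; _,_; proj₁; proj₂)
open import Function using (_∘_)
open import Function.Bundles using (Equivalence)
open import Relation.Binary.PropositionalEquality using (_≡_; refl)

module PathLifting {X X' : Set} (Step : X → X → Set) (Step' : X' → X' → Set)
  (R : X → X' → Set)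
  (simulate : ∀ {s s' t} → R s s' → Step s t → Σ[ t' ∈ X' ] Step' s' t' × R t t')
  where

  lift-finite : ∀ k (f : Fin (suc k) → X) →
    (∀ (i : Fin k) → Step (f (inject₁ i)) (f (suc i))) →
    ∀ {s'} → R (f zero) s' →
    Σ[ f' ∈ (Fin (suc k) → X') ]
      f' zero ≡ s' × (∀ i → R (f i) (f' i)) ×
      (∀ (i : Fin k) → Step' (f' (inject₁ i)) (f' (suc i)))
  lift-finite zero f steps {s'} r = (λ _ → s') , refl , (λ { zero → r }) , λ ()
  lift-finite (suc k) f steps {s'} r
    with simulate r (steps zero)
  ... | t' , step' , r₁
    with lift-finite k (f ∘ suc) (steps ∘ suc) r₁
  ... | f' , refl , related , steps' = s' ∷ f' , refl , related₀ , steps₀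
    where
    related₀ : ∀ i → R (f i) ((s' ∷ f') i)
    related₀ zero    = r
    related₀ (suc i) = related i

    steps₀ : ∀ (i : Fin (suc k)) → Step' ((s' ∷ f') (inject₁ i)) ((s' ∷ f') (suc i))
    steps₀ zero    = step'
    steps₀ (suc i) = steps' i

  lift-infinite : (g : ℕ → X) → (∀ i → Step (g i) (g (suc i))) →
    ∀ {s'} → R (g 0) s' →
    Σ[ g' ∈ (ℕ → X') ]
      g' 0 ≡ s' × (∀ i → R (g i) (g' i)) × (∀ i → Step' (g' i) (g' (suc i)))
  lift-infinite g steps {s'} r =
    proj₁ ∘ lifted , refl , proj₂ ∘ lifted ,
    λ i → proj₁ (proj₂ (simulate (proj₂ (lifted i)) (steps i)))
    where
    lifted : ∀ i → Σ[ t ∈ X' ] R (g i) t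
    lifted zero    = s' , r
    lifted (suc i) =
      let t' , _ , r' = simulate (proj₂ (lifted i)) (steps i) in t' , r'

module _ {A A' : ProtoAlg} {R : State A → State A' → Set}
  (sim : IsSimulation A A' R) where

  private
    simulate : ∀ {s s' t} → R s s' → AStep A s t →
               Σ[ t' ∈ State A' ] AStep A' s' t' × R t t'
    simulate r = proj₁ (proj₂ (proj₂ sim)) _ _ r _

    final-preserved : ∀ {s s'} → R s s' → IsFinal A s → IsFinal A' s'
    final-preserved r = Equivalence.to (proj₂ (proj₂ (proj₂ (proj₂ sim)) _ _ r))

    final-reflected : ∀ {s s'} → R s s' → IsFinal A' s' → IsFinal A s
    final-reflected r = Equivalence.from (proj₂ (proj₂ (proj₂ (proj₂ sim)) _ _ r))

  open PathLifting (AStep A) (AStep A') R simulate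

  simulation-lifts-runs : ∀ {s s'} → R s s' → (σ : Seq (State A)) → IsRunFrom A s σ →
    Σ[ σ' ∈ Seq (State A') ] IsRunFrom A' s' σ' × (∀ n → R (σ [ n ]) (σ' [ n ]))
  simulation-lifts-runs r (finite k f) (refl , steps , final) =
    let f' , start , related , steps' = lift-finite k f (proj₂ ∘ steps) r
    in finite k f' ,
       (start , (λ i → (proj₁ (steps i) ∘ final-reflected (related _)) , steps' i) ,
        final-preserved (related _) final) ,
       λ _ → related _
  simulation-lifts-runs r (infinite g) (refl , steps) =
    let g' , start , related , steps' = lift-infinite g (proj₂ ∘ steps) r
    in infinite g' ,
       (start , λ i → (proj₁ (steps i) ∘ final-reflected (related i)) , steps' i) ,
       λ n → related (n ∸ 1)

lemma1 : (A A' : ProtoAlg) (R : State A → State A' → Set)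
         (fI : ProtoAlg.Din A → ProtoAlg.Din A') →
         (∀ x → R (initState A x) (initState A' (fI x))) →
         IsSimulation A A' R →
         ∀ x (σ : Seq (State A)) → IsRun A x σ →
         Σ[ σ' ∈ Seq (State A') ] (IsRun A' (fI x) σ' ×
           (∀ (n : ℕ) → 1 ≤ n → R (σ [ n ]) (σ' [ n ])))
lemma1 A A' R fI initial-related sim x σ run =
  let σ' , run' , related = simulation-lifts-runs sim (initial-related x) σ run
  in σ' , run' , λ n _ → related n
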